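{- Let $H$ and $r$ be as in the context, with $|V|$ odd, and let $\hat y\in\mathbb{R}^{E(I)}$ be the random vector produced by the construction in the context. Then $\mathbb{E}[\hat y_e]=\tfrac12$ for every internal edge $e\in E(I)$.
   Context: Let $H=(V,E)$ be a 4-regular, 4-edge-connected multigraph with at least four vertices and no proper min-cuts: every $S\subseteq V$ with $1<|S|<|V|-1$ has $|\partial S|\ge 6$ (so $H$ has no parallel edges), where $\partial S$ is the set of edges with exactly one endpoint in $S$. A vertex $r$ is designated external; $I=V\setminus\{r\}$; edges not incident to $r$ form $E(I)$ (internal edges); $\partial I$ denotes the four edges incident to $r$. Suppose $|V|$ is odd. Obtain $\hat H$ from $H$ by splitting $r$ into two vertices $r_1,r_2$, each incident to two of the edges of $\partial r$, and adding two parallel edges between $r_1,r_2$. Sample a random perfect matching $M$ of $\hat H$ with $\Pr[e\in M]=\tfrac14$ for every edge; set $y_e=1$ if $e\in M$ and $y_e=\tfrac13$ otherwise. Then $|M\cap\partial I|\in\{0,2\}$. If $M\cap\partial I=\emptyset$ (local decrease): pick $e$ uniformly from $\partial I$, pick $f$ uniformly among the three internal edges sharing an endpoint with $e$, and set $\hat y_f=y_f-\tfrac13$. If $|M\cap\partial I|=2$ (local increase): pick $e$ uniformly from $M\cap\partial I$, pick $f$ uniformly among the three internal edges sharing an endpoint with $e$, and set $\hat y_f=y_f+\tfrac13$. All other coordinates satisfy $\hat y_g=y_g$, $g\in E(I)$.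
   Formalization: The probabilities of the random perfect matching of $\hat H$ are rational. -}

module Defs where

open import Data.Bool using (Bool; true; false; if_then_else_; _∧_; _∨_; _xor_; not)
open import Data.Nat using (ℕ; zero; suc; _+_; _≤_; _<_; _%_)
open import Data.Fin using (Fin; zero; suc; inject₁; fromℕ; _≟_)
open import Data.Fin.Subset using (Subset; ∣_∣)
open import Data.Vec using (lookup)
open import Data.Integer using (+_; -[1+_])
open import Data.Rational using (ℚ; 0ℚ; 1ℚ; _/_; -_) renaming (_+_ to _+ℚ_; _*_ to _*ℚ_; _≤_ to _≤ℚ_)
open import Relation.Nullary.Decidable using (⌊_⌋)
open import Relation.Binary.PropositionalEquality using (_≡_)

Σℚ : (n : ℕ) → (Fin n → ℚ) → ℚ
Σℚ zero    f = 0ℚ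
Σℚ (suc n) f = f zero +ℚ Σℚ n (λ i → f (suc i))

count : (n : ℕ) → (Fin n → Bool) → ℕ
count zero    p = 0
count (suc n) p = (if p zero then 1 else 0) + count n (λ i → p (suc i))

Σℕ : (n : ℕ) → (Fin n → ℕ) → ℕ
Σℕ zero    f = 0
Σℕ (suc n) f = f zero + Σℕ n (λ i → f (suc i))

_==_ : {n : ℕ} → Fin n → Fin n → Bool
x == y = ⌊ x ≟ y ⌋

-- Multigraphs: finitely many vertices and edges, each edge has two
-- endpoints (loops and parallel edges allowed).

record Graph : Set where
  field
    nV  : ℕ
    nE  : ℕ
    src : Fin nE → Fin nV
    tgt : Fin nE → Fin nV
open Graph public

-- number of ends of edge e at vertex v (a loop counts twice)
inc : (H : Graph) → Fin (nV H) → Fin (nE H) → ℕ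
inc H v e = (if src H e == v then 1 else 0) + (if tgt H e == v then 1 else 0)

degree : (H : Graph) → Fin (nV H) → ℕ
degree H v = Σℕ (nE H) (inc H v)

incident : (H : Graph) → Fin (nV H) → Fin (nE H) → Bool
incident H v e = (src H e == v) ∨ (tgt H e == v)

crosses : (H : Graph) → Subset (nV H) → Fin (nE H) → Bool
crosses H S e = lookup S (src H e) xor lookup S (tgt H e)

cutSize : (H : Graph) → Subset (nV H) → ℕ
cutSize H S = count (nE H) (crosses H S)

FourRegular : Graph → Set
FourRegular H = ∀ v → degree H v ≡ 4

FourEdgeConnected : Graph → Set
FourEdgeConnected H = ∀ (S : Subset (nV H)) → 0 < ∣ S ∣ → ∣ S ∣ < nV H → 4 ≤ cutSize H S

NoProperMinCut : Graph → Set
NoProperMinCut H = ∀ (S : Subset (nV H)) → 1 < ∣ S ∣ → suc ∣ S ∣ < nV H → 6 ≤ cutSize H S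

IsPerfectMatching : (H : Graph) → Subset (nE H) → Set
IsPerfectMatching H M =
  ∀ v → Σℕ (nE H) (λ e → if lookup M e then inc H v e else 0) ≡ 1

internal : (H : Graph) → Fin (nV H) → Fin (nE H) → Bool
internal H r e = not (incident H r e)

inBoundary : (H : Graph) → Fin (nV H) → Fin (nE H) → Bool
inBoundary H r e = incident H r e

adjInternal : (H : Graph) → Fin (nV H) → Fin (nE H) → Fin (nE H) → Bool
adjInternal H r e g =
  internal H r g ∧
  ((src H g == src H e) ∨ (src H g == tgt H e) ∨ (tgt H g == src H e) ∨ (tgt H g == tgt H e))

-- Splitting r.  side e = true means the endpoint(s) of e at r go to r₂,
-- otherwise to r₁.  Vertices of Ĥ: Fin (suc n), where inject₁ r is r₁,
-- fromℕ n is r₂ and inject₁ v is v for v ≠ r.  Edges of Ĥ: Fin (2 + m),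
-- where zero and suc zero are the two new parallel r₁r₂ edges and
-- suc (suc e) is the old edge e.

SplitOK : (H : Graph) → Fin (nV H) → (Fin (nE H) → Bool) → Set
SplitOK H r side = count (nE H) (λ e → inBoundary H r e ∧ side e) ≡ 2

liftEnd : (H : Graph) → Fin (nV H) → (Fin (nE H) → Bool) →
          Fin (nE H) → Fin (nV H) → Fin (suc (nV H))
liftEnd H r side e x =
  if x == r then (if side e then fromℕ (nV H) else inject₁ r) else inject₁ x

hatSrc : (H : Graph) → Fin (nV H) → (Fin (nE H) → Bool) →
         Fin (suc (suc (nE H))) → Fin (suc (nV H))
hatSrc H r side zero          = inject₁ r
hatSrc H r side (suc zero)    = inject₁ r
hatSrc H r side (suc (suc e)) = liftEnd H r side e (src H e)

hatTgt : (H : Graph) → Fin (nV H) → (Fin (nE H) → Bool) →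
         Fin (suc (suc (nE H))) → Fin (suc (nV H))
hatTgt H r side zero          = fromℕ (nV H)
hatTgt H r side (suc zero)    = fromℕ (nV H)
hatTgt H r side (suc (suc e)) = liftEnd H r side e (tgt H e)

hatH : (H : Graph) → Fin (nV H) → (Fin (nE H) → Bool) → Graph
hatH H r side = record
  { nV = suc (nV H) ; nE = suc (suc (nE H))
  ; src = hatSrc H r side ; tgt = hatTgt H r side }

-- A random perfect matching of Ĥ: a finitely supported probability
-- distribution (rational weights) on perfect matchings of Ĥ with
-- Pr[e ∈ M] = 1/4 for every edge e of Ĥ.

record MatchingDist (H : Graph) (r : Fin (nV H)) (side : Fin (nE H) → Bool) : Set where
  field
    k       : ℕ
    mat     : Fin k → Subset (suc (suc (nE H)))
    prob    : Fin k → ℚ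
    perfect : ∀ i → IsPerfectMatching (hatH H r side) (mat i)
    nonneg  : ∀ i → 0ℚ ≤ℚ prob i
    total   : Σℚ k prob ≡ 1ℚ
    marg    : ∀ (e : Fin (suc (suc (nE H)))) →
              Σℚ k (λ i → if lookup (mat i) e then prob i else 0ℚ) ≡ + 1 / 4
open MatchingDist public

inM : (H : Graph) → Subset (suc (suc (nE H))) → Fin (nE H) → Bool
inM H M e = lookup M (suc (suc e))

cBd : (H : Graph) → Fin (nV H) → Subset (suc (suc (nE H))) → ℕ
cBd H r M = count (nE H) (λ e → inBoundary H r e ∧ inM H M e)

yVal : (H : Graph) → Subset (suc (suc (nE H))) → Fin (nE H) → ℚ
yVal H M g = if inM H M g then 1ℚ else + 1 / 3

-- probability that e is picked in the first step, given M
pickE : (H : Graph) → Fin (nV H) → Subset (suc (suc (nE H))) → Fin (nE H) → ℚ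
pickE H r M e with cBd H r M
... | 0 = if inBoundary H r e then + 1 / 4 else 0ℚ
... | 2 = if inBoundary H r e ∧ inM H M e then + 1 / 2 else 0ℚ
... | _ = 0ℚ

-- probability that f is picked in the second step, given e
pickF : (H : Graph) → Fin (nV H) → Fin (nE H) → Fin (nE H) → ℚ
pickF H r e g = if adjInternal H r e g then + 1 / 3 else 0ℚ

-- the change applied to the picked coordinate, given M
delta : (H : Graph) → Fin (nV H) → Subset (suc (suc (nE H))) → ℚ
delta H r M with cBd H r M
... | 0 = - (+ 1 / 3)
... | 2 = + 1 / 3
... | _ = 0ℚ

-- ŷ_f for outcome (M, e picked, g picked)
hatY : (H : Graph) → Fin (nV H) → Subset (suc (suc (nE H))) →
       Fin (nE H) → Fin (nE H) → ℚ
hatY H r M g f = yVal H M f +ℚ (if g == f then delta H r M else 0ℚ)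

expectedHatY : (H : Graph) (r : Fin (nV H)) (side : Fin (nE H) → Bool) →
               MatchingDist H r side → Fin (nE H) → ℚ
expectedHatY H r side D f =
  Σℚ (k D) (λ i →
    Σℚ (nE H) (λ e →
      Σℚ (nE H) (λ g →
        prob D i *ℚ (pickE H r (mat D i) e *ℚ (pickF H r e g *ℚ hatY H r (mat D i) g f)))))

-- E[y_f] = ¼ · 1 + ¾ · ⅓ = ½, so it suffices that the expected correction of coordinate f vanishes.
-- The cut conditions make H loopless and without parallel edges, so every edge of ∂I has exactly
-- three internal neighbours and both random steps are probability distributions. Let
-- h = Σ_{e ∈ ∂I} Pr[f | e]. Given M, the expected correction is -⅓ · ¼ · h in a local decrease and
-- ⅓ · ½ · Σ_{e ∈ M ∩ ∂I} Pr[f | e] in a local increase. A perfect matching of Ĥ avoids ∂I exactly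
-- when it contains one of the two new edges r₁r₂, which happens with probability ½, and each edge
-- of ∂I lies in M with probability ¼; so the correction averages to -h/24 + h/24 = 0.
module Submission where

open import Defs
open import Algebra.Bundles using (CommutativeRing)
open import Data.Bool using (Bool; true; false; if_then_else_; _∧_; _∨_; _xor_; not; T)
open import Data.Bool.Properties using (∨-zeroʳ; ∧-assoc; ∧-identityʳ; ∧-zeroʳ)
open import Data.Nat using (ℕ; zero; suc; _+_; _*_; _≤_; _<_; _%_; z≤n; s≤s)
import Data.Nat.Properties as ℕ
open import Algebra.Properties.CommutativeSemigroup ℕ.+-commutativeSemigroup using (interchange)
open import Data.Fin using (Fin; zero; suc; inject₁; fromℕ; _≟_)
import Data.Fin.Properties as Fin
open import Data.Fin.Subset using (Subset; ∣_∣)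
open import Data.Vec using (lookup; tabulate)
open import Data.Vec.Properties using (lookup∘tabulate)
import Data.Integer as ℤ
open import Data.Rational using (ℚ; 0ℚ; 1ℚ; ½; _/_; -_; +-0-rawMonoid) renaming (_+_ to _+ℚ_; _*_ to _*ℚ_)
import Data.Rational.Properties as ℚ
open import Data.Rational.Solver using (module +-*-Solver)
open import Algebra.Definitions.RawMonoid +-0-rawMonoid using () renaming (_×_ to _×ℚ_)
open import Algebra.Properties.Semiring.Sum (CommutativeRing.semiring ℚ.+-*-commutativeRing)
  using (sum; sum-cong-≗; ∑-distrib-+; ∑-comm; *-distribˡ-sum; *-distribʳ-sum; sum-replicate-zero)
open import Data.Unit using (tt)
open import Data.Product using (_×_; _,_)
open import Data.Sum using (_⊎_; inj₁; inj₂)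
open import Function using (_∘_; Injective)
open import Relation.Nullary.Decidable using (toWitness; toWitnessFalse; dec-true; dec-false; isYes≗does)
open import Relation.Binary.PropositionalEquality

variable
  m n : ℕ

≡⇒== : {x y : Fin n} → x ≡ y → (x == y) ≡ true
≡⇒== {x = x} {y} x≡y = trans (isYes≗does (x ≟ y)) (dec-true (x ≟ y) x≡y)

≢⇒== : {x y : Fin n} → x ≢ y → (x == y) ≡ false
≢⇒== {x = x} {y} x≢y = trans (isYes≗does (x ≟ y)) (dec-false (x ≟ y) x≢y)

==⇒≡ : {x y : Fin n} → (x == y) ≡ true → x ≡ y
==⇒≡ eq = toWitness (subst T (sym eq) tt)

==⇒≢ : {x y : Fin n} → (x == y) ≡ false → x ≢ y
==⇒≢ eq = toWitnessFalse (subst (T ∘ not) (sym eq) tt)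

==-injective : (h : Fin m → Fin n) → Injective _≡_ _≡_ h → (x y : Fin m) → (h x == h y) ≡ (x == y)
==-injective h inj x y with x == y in eq
... | true  = ≡⇒== (cong h (==⇒≡ eq))
... | false = ≢⇒== (==⇒≢ eq ∘ inj)

χ : Bool → ℕ
χ b = if b then 1 else 0

count-cong : ∀ n {p q : Fin n → Bool} → (∀ i → p i ≡ q i) → count n p ≡ count n q
count-cong zero    _   = refl
count-cong (suc n) p≗q = cong₂ (λ b c → χ b + c) (p≗q zero) (count-cong n (p≗q ∘ suc))

Σℕ-cong : ∀ n {f g : Fin n → ℕ} → (∀ i → f i ≡ g i) → Σℕ n f ≡ Σℕ n g
Σℕ-cong zero    _   = refl
Σℕ-cong (suc n) f≗g = cong₂ _+_ (f≗g zero) (Σℕ-cong n (f≗g ∘ suc))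

Σℕ-χ : ∀ n (p : Fin n → Bool) → Σℕ n (χ ∘ p) ≡ count n p
Σℕ-χ zero    p = refl
Σℕ-χ (suc n) p = cong (χ (p zero) +_) (Σℕ-χ n (p ∘ suc))

Σℕ-χ+χ : ∀ n (p q : Fin n → Bool) → Σℕ n (λ i → χ (p i) + χ (q i)) ≡ count n p + count n q
Σℕ-χ+χ zero    p q = refl
Σℕ-χ+χ (suc n) p q =
  trans (cong (χ (p zero) + χ (q zero) +_) (Σℕ-χ+χ n (p ∘ suc) (q ∘ suc)))
        (interchange (χ (p zero)) (χ (q zero)) (count n (p ∘ suc)) (count n (q ∘ suc)))

count-∨ : ∀ n (p q : Fin n → Bool) → (∀ i → p i ∧ q i ≡ false) →
          count n (λ i → p i ∨ q i) ≡ count n p + count n q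
count-∨ zero    p q disj = refl
count-∨ (suc n) p q disj =
  trans (cong₂ _+_ (χ-∨ (p zero) (q zero) (disj zero)) (count-∨ n (p ∘ suc) (q ∘ suc) (disj ∘ suc)))
        (interchange (χ (p zero)) (χ (q zero)) (count n (p ∘ suc)) (count n (q ∘ suc)))
  where
  χ-∨ : ∀ a b → a ∧ b ≡ false → χ (a ∨ b) ≡ χ a + χ b
  χ-∨ true  false _ = refl
  χ-∨ false b     _ = refl

count-split : ∀ n (q p : Fin n → Bool) →
              count n p ≡ count n (λ i → not (q i) ∧ p i) + count n (λ i → q i ∧ p i)
count-split zero    q p = refl
count-split (suc n) q p =
  trans (cong₂ _+_ (χ-split (q zero) (p zero)) (count-split n (q ∘ suc) (p ∘ suc)))
        (interchange (χ (not (q zero) ∧ p zero)) (χ (q zero ∧ p zero))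
                     (count n (λ i → not (q (suc i)) ∧ p (suc i))) (count n (λ i → q (suc i) ∧ p (suc i))))
  where
  χ-split : ∀ a b → χ b ≡ χ (not a ∧ b) + χ (a ∧ b)
  χ-split true  b = refl
  χ-split false b = sym (ℕ.+-identityʳ (χ b))

count-mono : ∀ n {p q : Fin n → Bool} → (∀ i → p i ≡ true → q i ≡ true) → count n p ≤ count n q
count-mono zero    p⇒q = z≤n
count-mono (suc n) {p} {q} p⇒q =
  ℕ.+-mono-≤ (χ-mono (p zero) (q zero) (p⇒q zero)) (count-mono n (p⇒q ∘ suc))
  where
  χ-mono : ∀ a b → (a ≡ true → b ≡ true) → χ a ≤ χ b
  χ-mono true  b a⇒b rewrite a⇒b refl = ℕ.≤-refl
  χ-mono false b _   = z≤n

count≡0 : ∀ n (p : Fin n → Bool) → count n p ≡ 0 → ∀ i → p i ≡ false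
count≡0 (suc n) p c≡0 zero    with p zero
count≡0 (suc n) p ()  zero    | true
count≡0 (suc n) p c≡0 zero    | false = refl
count≡0 (suc n) p c≡0 (suc i) = count≡0 n (p ∘ suc) (ℕ.m+n≡0⇒n≡0 (χ (p zero)) c≡0) i

count-== : ∀ n (x : Fin n) → count n (_== x) ≡ 1
count-== (suc n) zero    = cong suc (count-none n)
  where
  count-none : ∀ n → count n (λ _ → false) ≡ 0
  count-none zero    = refl
  count-none (suc n) = count-none n
count-== (suc n) (suc x) = trans (count-cong n (λ i → ==-injective suc Fin.suc-injective i x)) (count-== n x)

∣tabulate∣ : ∀ n (p : Fin n → Bool) → ∣ tabulate {n = n} p ∣ ≡ count n p
∣tabulate∣ zero    p = refl
∣tabulate∣ (suc n) p with p zero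
... | true  = cong suc (∣tabulate∣ n (p ∘ suc))
... | false = ∣tabulate∣ n (p ∘ suc)

-- With p, q testing whether the ends of an edge lie in S, this is Σ_{v ∈ S} deg v = |∂S| + 2 |E(S)|.
count+count≡count-xor+2*count-∧ : ∀ n (p q : Fin n → Bool) →
  count n p + count n q ≡ count n (λ i → p i xor q i) + 2 * count n (λ i → p i ∧ q i)
count+count≡count-xor+2*count-∧ zero    p q = refl
count+count≡count-xor+2*count-∧ (suc n) p q = begin
  (χ p₀ + count n p′) + (χ q₀ + count n q′)
    ≡⟨ interchange (χ p₀) (count n p′) (χ q₀) (count n q′) ⟩
  (χ p₀ + χ q₀) + (count n p′ + count n q′)
    ≡⟨ cong₂ _+_ (χ-ends p₀ q₀) (count+count≡count-xor+2*count-∧ n p′ q′) ⟩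
  (χ x₀ + 2 * χ c₀) + (count n x′ + 2 * count n c′)
    ≡⟨ interchange (χ x₀) (2 * χ c₀) (count n x′) (2 * count n c′) ⟩
  (χ x₀ + count n x′) + (2 * χ c₀ + 2 * count n c′)
    ≡⟨ cong (χ x₀ + count n x′ +_) (sym (ℕ.*-distribˡ-+ 2 (χ c₀) (count n c′))) ⟩
  (χ x₀ + count n x′) + 2 * (χ c₀ + count n c′) ∎
  where
  open ≡-Reasoning
  p₀ q₀ x₀ c₀ : Bool
  p₀ = p zero
  q₀ = q zero
  x₀ = p₀ xor q₀
  c₀ = p₀ ∧ q₀
  p′ q′ x′ c′ : Fin n → Bool
  p′ = p ∘ suc
  q′ = q ∘ suc
  x′ i = p′ i xor q′ i
  c′ i = p′ i ∧ q′ i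
  χ-ends : ∀ a b → χ a + χ b ≡ χ (a xor b) + 2 * χ (a ∧ b)
  χ-ends true  true  = refl
  χ-ends true  false = refl
  χ-ends false true  = refl
  χ-ends false false = refl

count-∧≤ : ∀ n (p q : Fin n → Bool) {s k : ℕ} → s ≤ count n (λ i → p i xor q i) →
           count n p + count n q ≡ s + 2 * k → count n (λ i → p i ∧ q i) ≤ k
count-∧≤ n p q {s} {k} s≤cut ends = ℕ.*-cancelˡ-≤ 2 (ℕ.+-cancelˡ-≤ s _ _ (begin
  s + 2 * count n (λ i → p i ∧ q i)                             ≤⟨ ℕ.+-monoˡ-≤ _ s≤cut ⟩
  count n (λ i → p i xor q i) + 2 * count n (λ i → p i ∧ q i)   ≡⟨ count+count≡count-xor+2*count-∧ n p q ⟨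
  count n p + count n q                                         ≡⟨ ends ⟩
  s + 2 * k                                                     ∎))
  where open ℕ.≤-Reasoning

-- Loops and parallel edges

module _ (H : Graph) where

  cutSize-tabulate : (P : Fin (nV H) → Bool) →
                     cutSize H (tabulate P) ≡ count (nE H) (λ e → P (src H e) xor P (tgt H e))
  cutSize-tabulate P =
    count-cong (nE H) (λ e → cong₂ _xor_ (lookup∘tabulate P (src H e)) (lookup∘tabulate P (tgt H e)))

  degree≡count+count : ∀ v →
    degree H v ≡ count (nE H) (λ e → src H e == v) + count (nE H) (λ e → tgt H e == v)
  degree≡count+count v = Σℕ-χ+χ (nE H) (λ e → src H e == v) (λ e → tgt H e == v)

  incident-src : ∀ e → incident H (src H e) e ≡ true
  incident-src e = cong (_∨ (tgt H e == src H e)) (≡⇒== refl)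

  incident-tgt : ∀ e → incident H (tgt H e) e ≡ true
  incident-tgt e = trans (cong ((src H e == tgt H e) ∨_) (≡⇒== refl)) (∨-zeroʳ _)

module _ (H : Graph) (reg : FourRegular H) where

  loopless : 1 < nV H → FourEdgeConnected H → ∀ x e → (src H e == x) ∧ (tgt H e == x) ≡ false
  loopless 1<n fec x = count≡0 (nE H) _ (ℕ.n≤0⇒n≡0 (count-∧≤ (nE H) at-src at-tgt cut ends))
    where
    at-src at-tgt : Fin (nE H) → Bool
    at-src e = src H e == x
    at-tgt e = tgt H e == x
    ∣singleton∣ : ∣ tabulate (_== x) ∣ ≡ 1
    ∣singleton∣ = trans (∣tabulate∣ (nV H) (_== x)) (count-== (nV H) x)
    cut : 4 ≤ count (nE H) (λ e → at-src e xor at-tgt e)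
    cut = subst (4 ≤_) (cutSize-tabulate H (_== x))
                (fec (tabulate (_== x)) (subst (0 <_) (sym ∣singleton∣) (s≤s z≤n))
                                        (subst (_< nV H) (sym ∣singleton∣) 1<n))
    ends : count (nE H) at-src + count (nE H) at-tgt ≡ 4 + 2 * 0
    ends = trans (sym (degree≡count+count H x)) (reg x)

  ≤1-edge-between : 3 < nV H → NoProperMinCut H → ∀ {u v} → u ≢ v →
                    count (nE H) (λ e → incident H u e ∧ incident H v e) ≤ 1
  ≤1-edge-between 3<n npm {u} {v} u≢v =
    ℕ.≤-trans (count-mono (nE H) (λ e → joins⇒inside (src H e == u) (tgt H e == u)
                                                       (src H e == v) (tgt H e == v)
                                                       (distinct (src H e)) (distinct (tgt H e))))
              (count-∧≤ (nE H) (P ∘ src H) (P ∘ tgt H) cut ends)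
    where
    P : Fin (nV H) → Bool
    P y = (y == u) ∨ (y == v)
    distinct : ∀ y → (y == u) ∧ (y == v) ≡ false
    distinct y with y == u in eq
    ... | true  = ≢⇒== (λ y≡v → u≢v (trans (sym (==⇒≡ eq)) y≡v))
    ... | false = refl
    count-P∘ : (end : Fin (nE H) → Fin (nV H)) →
               count (nE H) (P ∘ end) ≡ count (nE H) (λ e → end e == u) + count (nE H) (λ e → end e == v)
    count-P∘ end = count-∨ (nE H) _ _ (distinct ∘ end)
    ∣pair∣ : ∣ tabulate P ∣ ≡ 2
    ∣pair∣ = trans (∣tabulate∣ (nV H) P)
                  (trans (count-∨ (nV H) _ _ distinct) (cong₂ _+_ (count-== (nV H) u) (count-== (nV H) v)))
    cut : 6 ≤ count (nE H) (λ e → P (src H e) xor P (tgt H e))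
    cut = subst (6 ≤_) (cutSize-tabulate H P)
                (npm (tabulate P) (subst (1 <_) (sym ∣pair∣) (s≤s (s≤s z≤n)))
                                  (subst (λ s → suc s < nV H) (sym ∣pair∣) 3<n))
    ends : count (nE H) (P ∘ src H) + count (nE H) (P ∘ tgt H) ≡ 6 + 2 * 1
    ends = begin
      count (nE H) (P ∘ src H) + count (nE H) (P ∘ tgt H)
        ≡⟨ cong₂ _+_ (count-P∘ (src H)) (count-P∘ (tgt H)) ⟩
      (count (nE H) (λ e → src H e == u) + count (nE H) (λ e → src H e == v)) +
      (count (nE H) (λ e → tgt H e == u) + count (nE H) (λ e → tgt H e == v))
        ≡⟨ interchange (count (nE H) (λ e → src H e == u)) _ (count (nE H) (λ e → tgt H e == u)) _ ⟩
      (count (nE H) (λ e → src H e == u) + count (nE H) (λ e → tgt H e == u)) +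
      (count (nE H) (λ e → src H e == v) + count (nE H) (λ e → tgt H e == v))
        ≡⟨ cong₂ _+_ (trans (sym (degree≡count+count H u)) (reg u))
                     (trans (sym (degree≡count+count H v)) (reg v)) ⟩
      8 ∎
      where open ≡-Reasoning
    joins⇒inside : ∀ a b c d → a ∧ c ≡ false → b ∧ d ≡ false →
                   (a ∨ b) ∧ (c ∨ d) ≡ true → (a ∨ c) ∧ (b ∨ d) ≡ true
    joins⇒inside true  true  c     d     _  _  _  = refl
    joins⇒inside true  false false true  _  _  _  = refl
    joins⇒inside true  false false false _  _  ()
    joins⇒inside true  false true  d     () _  _
    joins⇒inside false true  true  false _  _  _  = refl
    joins⇒inside false true  true  true  _  () _
    joins⇒inside false true  false true  _  () _
    joins⇒inside false true  false false _  _  ()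
    joins⇒inside false false c     d     _  _  ()

module _ (H : Graph) (four : 4 ≤ nV H) (reg : FourRegular H)
         (fec : FourEdgeConnected H) (npm : NoProperMinCut H) where

  no-loop : ∀ x e → (src H e == x) ∧ (tgt H e == x) ≡ false
  no-loop = loopless H reg (ℕ.≤-trans (s≤s (s≤s z≤n)) four) fec

  count-incident : ∀ v → count (nE H) (incident H v) ≡ 4
  count-incident v = trans (count-∨ (nE H) _ _ (no-loop v)) (trans (sym (degree≡count+count H v)) (reg v))

  internal-neighbours : ∀ {r v e} → v ≢ r → incident H r e ∧ incident H v e ≡ true →
                        count (nE H) (λ g → not (incident H r g) ∧ incident H v g) ≡ 3
  internal-neighbours {r} {v} {e} v≢r e-joins = ℕ.+-cancelʳ-≡ 1 _ 3 (begin
    count (nE H) (λ g → not (incident H r g) ∧ incident H v g) + 1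
      ≡⟨ cong (count (nE H) (λ g → not (incident H r g) ∧ incident H v g) +_) (sym joining≡1) ⟩
    count (nE H) (λ g → not (incident H r g) ∧ incident H v g) +
    count (nE H) (λ g → incident H r g ∧ incident H v g)
      ≡⟨ sym (count-split (nE H) (incident H r) (incident H v)) ⟩
    count (nE H) (incident H v)
      ≡⟨ count-incident v ⟩
    4 ∎)
    where
    open ≡-Reasoning
    joining≡1 : count (nE H) (λ g → incident H r g ∧ incident H v g) ≡ 1
    joining≡1 = ℕ.≤-antisym (≤1-edge-between H reg four npm (v≢r ∘ sym))
      (subst (_≤ _) (count-== (nE H) e)
        (count-mono (nE H) (λ g g==e →
          subst (λ g → incident H r g ∧ incident H v g ≡ true) (sym (==⇒≡ g==e)) e-joins)))

  boundary-edge-ends : ∀ {r e} → incident H r e ≡ true →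
                       (src H e ≡ r × tgt H e ≢ r) ⊎ (tgt H e ≡ r × src H e ≢ r)
  boundary-edge-ends {r} {e} e∈∂r with src H e == r in src==r
  ... | true  = inj₁ (==⇒≡ src==r ,
                      ==⇒≢ (subst (λ b → b ∧ (tgt H e == r) ≡ false) src==r (no-loop r e)))
  ... | false = inj₂ (==⇒≡ e∈∂r , ==⇒≢ src==r)

  adjInternal-count : ∀ {r e} → incident H r e ≡ true → count (nE H) (adjInternal H r e) ≡ 3
  adjInternal-count {r} {e} e∈∂r with boundary-edge-ends e∈∂r
  ... | inj₁ (src≡r , tgt≢r) =
    trans (count-cong (nE H) adjacent) (internal-neighbours tgt≢r (cong₂ _∧_ e∈∂r (incident-tgt H e)))
    where
    adjacent : ∀ g → adjInternal H r e g ≡ not (incident H r g) ∧ incident H (tgt H e) g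
    adjacent g rewrite src≡r =
      first-end (src H g == r) (tgt H g == r) (src H g == tgt H e) (tgt H g == tgt H e)
      where
      first-end : ∀ a b c d → not (a ∨ b) ∧ (a ∨ c ∨ b ∨ d) ≡ not (a ∨ b) ∧ (c ∨ d)
      first-end true  b     c d = refl
      first-end false true  c d = refl
      first-end false false c d = refl
  ... | inj₂ (tgt≡r , src≢r) =
    trans (count-cong (nE H) adjacent) (internal-neighbours src≢r (cong₂ _∧_ e∈∂r (incident-src H e)))
    where
    adjacent : ∀ g → adjInternal H r e g ≡ not (incident H r g) ∧ incident H (src H e) g
    adjacent g rewrite tgt≡r =
      second-end (src H g == r) (tgt H g == r) (src H g == src H e) (tgt H g == src H e)
      where
      second-end : ∀ a b c d → not (a ∨ b) ∧ (c ∨ a ∨ d ∨ b) ≡ not (a ∨ b) ∧ (c ∨ d)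
      second-end true  b     c     d     = refl
      second-end false true  c     d     = refl
      second-end false false true  d     = refl
      second-end false false false true  = refl
      second-end false false false false = refl

Σℚ≡sum : ∀ n (f : Fin n → ℚ) → Σℚ n f ≡ sum f
Σℚ≡sum zero    f = refl
Σℚ≡sum (suc n) f = cong (f zero +ℚ_) (Σℚ≡sum n (f ∘ suc))

Σℚ-cong : ∀ n {f g : Fin n → ℚ} → (∀ i → f i ≡ g i) → Σℚ n f ≡ Σℚ n g
Σℚ-cong zero    _   = refl
Σℚ-cong (suc n) f≗g = cong₂ _+ℚ_ (f≗g zero) (Σℚ-cong n (f≗g ∘ suc))

Σℚ-+ : ∀ n (f g : Fin n → ℚ) → Σℚ n (λ i → f i +ℚ g i) ≡ Σℚ n f +ℚ Σℚ n g
Σℚ-+ n f g rewrite Σℚ≡sum n (λ i → f i +ℚ g i) | Σℚ≡sum n f | Σℚ≡sum n g = ∑-distrib-+ f g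

*-distribˡ-Σℚ : ∀ n (c : ℚ) (f : Fin n → ℚ) → c *ℚ Σℚ n f ≡ Σℚ n (λ i → c *ℚ f i)
*-distribˡ-Σℚ n c f rewrite Σℚ≡sum n f | Σℚ≡sum n (λ i → c *ℚ f i) = *-distribˡ-sum c f

*-distribʳ-Σℚ : ∀ n (c : ℚ) (f : Fin n → ℚ) → Σℚ n f *ℚ c ≡ Σℚ n (λ i → f i *ℚ c)
*-distribʳ-Σℚ n c f rewrite Σℚ≡sum n f | Σℚ≡sum n (λ i → f i *ℚ c) = *-distribʳ-sum c f

Σℚ-comm : ∀ m n (f : Fin m → Fin n → ℚ) →
          Σℚ m (λ i → Σℚ n (f i)) ≡ Σℚ n (λ j → Σℚ m (λ i → f i j))
Σℚ-comm m n f = begin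
  Σℚ m (λ i → Σℚ n (f i))           ≡⟨ trans (Σℚ≡sum m _) (sum-cong-≗ (λ i → Σℚ≡sum n (f i))) ⟩
  sum (λ i → sum (f i))             ≡⟨ ∑-comm f ⟩
  sum (λ j → sum (λ i → f i j))     ≡⟨ trans (Σℚ≡sum n _) (sum-cong-≗ (λ j → Σℚ≡sum m (λ i → f i j))) ⟨
  Σℚ n (λ j → Σℚ m (λ i → f i j))   ∎
  where open ≡-Reasoning

Σℚ-zero : ∀ n → Σℚ n (λ _ → 0ℚ) ≡ 0ℚ
Σℚ-zero n = trans (Σℚ≡sum n _) (sum-replicate-zero n)

Σℚ-if : ∀ n (p : Fin n → Bool) (c : ℚ) → Σℚ n (λ i → if p i then c else 0ℚ) ≡ count n p ×ℚ c
Σℚ-if zero    p c = refl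
Σℚ-if (suc n) p c with p zero
... | true  = cong (c +ℚ_) (Σℚ-if n (p ∘ suc) c)
... | false = trans (ℚ.+-identityˡ _) (Σℚ-if n (p ∘ suc) c)

Σℚ-select : ∀ n (a : Fin n → ℚ) (f : Fin n) (δ : ℚ) →
            Σℚ n (λ g → a g *ℚ (if g == f then δ else 0ℚ)) ≡ a f *ℚ δ
Σℚ-select (suc n) a zero δ = begin
  a zero *ℚ δ +ℚ Σℚ n (λ g → a (suc g) *ℚ 0ℚ)
    ≡⟨ cong (a zero *ℚ δ +ℚ_) (trans (Σℚ-cong n (λ g → ℚ.*-zeroʳ (a (suc g)))) (Σℚ-zero n)) ⟩
  a zero *ℚ δ +ℚ 0ℚ
    ≡⟨ ℚ.+-identityʳ _ ⟩
  a zero *ℚ δ ∎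
  where open ≡-Reasoning
Σℚ-select (suc n) a (suc f) δ = begin
  a zero *ℚ 0ℚ +ℚ Σℚ n (λ g → a (suc g) *ℚ (if suc g == suc f then δ else 0ℚ))
    ≡⟨ cong₂ _+ℚ_ (ℚ.*-zeroʳ (a zero)) (Σℚ-cong n (λ g →
         cong (λ b → a (suc g) *ℚ (if b then δ else 0ℚ)) (==-injective suc Fin.suc-injective g f))) ⟩
  0ℚ +ℚ Σℚ n (λ g → a (suc g) *ℚ (if g == f then δ else 0ℚ))
    ≡⟨ trans (ℚ.+-identityˡ _) (Σℚ-select n (a ∘ suc) f δ) ⟩
  a (suc f) *ℚ δ ∎
  where open ≡-Reasoning

Σℚ-shift-at : ∀ n (b : Fin n → ℚ) (y δ : ℚ) (f : Fin n) →
              Σℚ n (λ g → b g *ℚ (y +ℚ (if g == f then δ else 0ℚ))) ≡ Σℚ n b *ℚ y +ℚ b f *ℚ δ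
Σℚ-shift-at n b y δ f = begin
  Σℚ n (λ g → b g *ℚ (y +ℚ (if g == f then δ else 0ℚ)))
    ≡⟨ Σℚ-cong n (λ g → ℚ.*-distribˡ-+ (b g) y _) ⟩
  Σℚ n (λ g → b g *ℚ y +ℚ b g *ℚ (if g == f then δ else 0ℚ))
    ≡⟨ Σℚ-+ n _ _ ⟩
  Σℚ n (λ g → b g *ℚ y) +ℚ Σℚ n (λ g → b g *ℚ (if g == f then δ else 0ℚ))
    ≡⟨ cong₂ _+ℚ_ (sym (*-distribʳ-Σℚ n y b)) (Σℚ-select n b f δ) ⟩
  Σℚ n b *ℚ y +ℚ b f *ℚ δ ∎
  where open ≡-Reasoning

two-stage-choice : ∀ n (a : Fin n → ℚ) (b : Fin n → Fin n → ℚ) (y δ : ℚ) (f : Fin n) →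
  Σℚ n a ≡ 1ℚ → (∀ e → a e *ℚ Σℚ n (b e) ≡ a e) →
  Σℚ n (λ e → Σℚ n (λ g → a e *ℚ (b e g *ℚ (y +ℚ (if g == f then δ else 0ℚ)))))
    ≡ y +ℚ δ *ℚ Σℚ n (λ e → a e *ℚ b e f)
two-stage-choice n a b y δ f Σa≡1 a-stochastic = begin
  Σℚ n (λ e → Σℚ n (λ g → a e *ℚ (b e g *ℚ (y +ℚ (if g == f then δ else 0ℚ)))))
    ≡⟨ Σℚ-cong n (λ e → sym (*-distribˡ-Σℚ n (a e) _)) ⟩
  Σℚ n (λ e → a e *ℚ Σℚ n (λ g → b e g *ℚ (y +ℚ (if g == f then δ else 0ℚ))))
    ≡⟨ Σℚ-cong n (λ e → cong (a e *ℚ_) (Σℚ-shift-at n (b e) y δ f)) ⟩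
  Σℚ n (λ e → a e *ℚ (Σℚ n (b e) *ℚ y +ℚ b e f *ℚ δ))
    ≡⟨ Σℚ-cong n (λ e → regroup (a e) (Σℚ n (b e)) y (b e f) δ) ⟩
  Σℚ n (λ e → (a e *ℚ Σℚ n (b e)) *ℚ y +ℚ δ *ℚ (a e *ℚ b e f))
    ≡⟨ Σℚ-cong n (λ e → cong (λ z → z *ℚ y +ℚ δ *ℚ (a e *ℚ b e f)) (a-stochastic e)) ⟩
  Σℚ n (λ e → a e *ℚ y +ℚ δ *ℚ (a e *ℚ b e f))
    ≡⟨ Σℚ-+ n _ _ ⟩
  Σℚ n (λ e → a e *ℚ y) +ℚ Σℚ n (λ e → δ *ℚ (a e *ℚ b e f))
    ≡⟨ cong₂ _+ℚ_ (sym (*-distribʳ-Σℚ n y a)) (sym (*-distribˡ-Σℚ n δ _)) ⟩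
  Σℚ n a *ℚ y +ℚ δ *ℚ Σℚ n (λ e → a e *ℚ b e f)
    ≡⟨ cong (λ z → z *ℚ y +ℚ δ *ℚ Σℚ n (λ e → a e *ℚ b e f)) Σa≡1 ⟩
  1ℚ *ℚ y +ℚ δ *ℚ Σℚ n (λ e → a e *ℚ b e f)
    ≡⟨ cong (_+ℚ δ *ℚ Σℚ n (λ e → a e *ℚ b e f)) (ℚ.*-identityˡ y) ⟩
  y +ℚ δ *ℚ Σℚ n (λ e → a e *ℚ b e f) ∎
  where
  open ≡-Reasoning
  open +-*-Solver
  regroup : ∀ a S y b δ → a *ℚ (S *ℚ y +ℚ b *ℚ δ) ≡ (a *ℚ S) *ℚ y +ℚ δ *ℚ (a *ℚ b)
  regroup = solve 5 (λ a S y b δ → a :* (S :* y :+ b :* δ) := (a :* S) :* y :+ δ :* (a :* b)) refl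

¼ ⅓ ⅔ : ℚ
¼ = ℤ.+ 1 / 4
⅓ = ℤ.+ 1 / 3
⅔ = ℤ.+ 2 / 3

𝟙 : Bool → ℚ
𝟙 true  = 1ℚ
𝟙 false = 0ℚ

*𝟙≡if : ∀ (p : ℚ) b → p *ℚ 𝟙 b ≡ (if b then p else 0ℚ)
*𝟙≡if p true  = ℚ.*-identityʳ p
*𝟙≡if p false = ℚ.*-zeroʳ p

if-*ℚ : ∀ b (c x : ℚ) → (if b then c else 0ℚ) *ℚ x ≡ c *ℚ (𝟙 b *ℚ x)
if-*ℚ b c x = trans (cong (_*ℚ x) (sym (*𝟙≡if c b))) (ℚ.*-assoc c (𝟙 b) x)

𝟙-∧ : ∀ a b → 𝟙 (a ∧ b) ≡ 𝟙 a *ℚ 𝟙 b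
𝟙-∧ true  b = sym (ℚ.*-identityˡ (𝟙 b))
𝟙-∧ false b = sym (ℚ.*-zeroˡ (𝟙 b))

if-∧-*ℚ : ∀ a b (c x : ℚ) → (if a ∧ b then c else 0ℚ) *ℚ x ≡ c *ℚ ((𝟙 a *ℚ x) *ℚ 𝟙 b)
if-∧-*ℚ a b c x = begin
  (if a ∧ b then c else 0ℚ) *ℚ x   ≡⟨ if-*ℚ (a ∧ b) c x ⟩
  c *ℚ (𝟙 (a ∧ b) *ℚ x)            ≡⟨ cong (λ z → c *ℚ (z *ℚ x)) (𝟙-∧ a b) ⟩
  c *ℚ ((𝟙 a *ℚ 𝟙 b) *ℚ x)         ≡⟨ cong (c *ℚ_) (exchange (𝟙 a) (𝟙 b) x) ⟩
  c *ℚ ((𝟙 a *ℚ x) *ℚ 𝟙 b)         ∎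
  where
  open ≡-Reasoning
  open +-*-Solver
  exchange : ∀ a b x → (a *ℚ b) *ℚ x ≡ (a *ℚ x) *ℚ b
  exchange = solve 3 (λ a b x → (a :* b) :* x := (a :* x) :* b) refl

𝟙-*-𝟙-disjoint : ∀ a b (x : ℚ) → a ∧ b ≡ false → (𝟙 a *ℚ x) *ℚ 𝟙 b ≡ 0ℚ
𝟙-*-𝟙-disjoint true  false x _ = ℚ.*-zeroʳ (1ℚ *ℚ x)
𝟙-*-𝟙-disjoint false b     x _ = trans (cong (_*ℚ 𝟙 b) (ℚ.*-zeroˡ x)) (ℚ.*-zeroˡ (𝟙 b))

module Expectation {H : Graph} {r : Fin (nV H)} {side : Fin (nE H) → Bool}
                   (D : MatchingDist H r side) where

  𝔼 : (Subset (suc (suc (nE H))) → ℚ) → ℚ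
  𝔼 X = Σℚ (k D) (λ i → prob D i *ℚ X (mat D i))

  𝔼-cong : ∀ {X Y} → (∀ i → X (mat D i) ≡ Y (mat D i)) → 𝔼 X ≡ 𝔼 Y
  𝔼-cong X≗Y = Σℚ-cong (k D) (λ i → cong (prob D i *ℚ_) (X≗Y i))

  𝔼-+ : ∀ X Y → 𝔼 (λ M → X M +ℚ Y M) ≡ 𝔼 X +ℚ 𝔼 Y
  𝔼-+ X Y = trans (Σℚ-cong (k D) (λ i → ℚ.*-distribˡ-+ (prob D i) _ _)) (Σℚ-+ (k D) _ _)

  𝔼-* : ∀ c X → 𝔼 (λ M → c *ℚ X M) ≡ c *ℚ 𝔼 X
  𝔼-* c X = trans (Σℚ-cong (k D) (λ i → swap (prob D i) c (X (mat D i)))) (sym (*-distribˡ-Σℚ (k D) c _))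
    where
    open +-*-Solver
    swap : ∀ p c x → p *ℚ (c *ℚ x) ≡ c *ℚ (p *ℚ x)
    swap = solve 3 (λ p c x → p :* (c :* x) := c :* (p :* x)) refl

  𝔼-const : ∀ c → 𝔼 (λ _ → c) ≡ c
  𝔼-const c = begin
    Σℚ (k D) (λ i → prob D i *ℚ c)   ≡⟨ sym (*-distribʳ-Σℚ (k D) c (prob D)) ⟩
    Σℚ (k D) (prob D) *ℚ c           ≡⟨ cong (_*ℚ c) (total D) ⟩
    1ℚ *ℚ c                          ≡⟨ ℚ.*-identityˡ c ⟩
    c                                ∎
    where open ≡-Reasoning

  𝔼-𝟙 : ∀ ê → 𝔼 (λ M → 𝟙 (lookup M ê)) ≡ ¼
  𝔼-𝟙 ê = trans (Σℚ-cong (k D) (λ i → *𝟙≡if (prob D i) (lookup (mat D i) ê))) (marg D ê)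

  𝔼-Σℚ : ∀ n (X : Fin n → Subset (suc (suc (nE H))) → ℚ) →
         𝔼 (λ M → Σℚ n (λ e → X e M)) ≡ Σℚ n (λ e → 𝔼 (X e))
  𝔼-Σℚ n X = trans (Σℚ-cong (k D) (λ i → *-distribˡ-Σℚ n (prob D i) _)) (Σℚ-comm (k D) n _)

  𝔼-affine : ∀ X Y Z a b →
             𝔼 (λ M → X M +ℚ (a *ℚ Y M +ℚ b *ℚ Z M)) ≡ 𝔼 X +ℚ (a *ℚ 𝔼 Y +ℚ b *ℚ 𝔼 Z)
  𝔼-affine X Y Z a b = begin
    𝔼 (λ M → X M +ℚ (a *ℚ Y M +ℚ b *ℚ Z M))
      ≡⟨ 𝔼-+ X (λ M → a *ℚ Y M +ℚ b *ℚ Z M) ⟩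
    𝔼 X +ℚ 𝔼 (λ M → a *ℚ Y M +ℚ b *ℚ Z M)
      ≡⟨ cong (𝔼 X +ℚ_) (𝔼-+ (λ M → a *ℚ Y M) (λ M → b *ℚ Z M)) ⟩
    𝔼 X +ℚ (𝔼 (λ M → a *ℚ Y M) +ℚ 𝔼 (λ M → b *ℚ Z M))
      ≡⟨ cong (𝔼 X +ℚ_) (cong₂ _+ℚ_ (𝔼-* a Y) (𝔼-* b Z)) ⟩
    𝔼 X +ℚ (a *ℚ 𝔼 Y +ℚ b *ℚ 𝔼 Z) ∎
    where open ≡-Reasoning

-- Perfect matchings of the split graph

newEdges : ∀ {n} → Subset (suc (suc n)) → ℚ
newEdges M = 𝟙 (lookup M zero) +ℚ 𝟙 (lookup M (suc zero))

-- a, b: the two new edges r₁r₂ lie in M; x, y: the edges of M ∩ ∂I at r₁ and at r₂.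
two-copies : ∀ a b {c x y} → c ≡ x + y → χ a + (χ b + x) ≡ 1 → χ a + (χ b + y) ≡ 1 →
             (c ≡ 0 × 𝟙 a +ℚ 𝟙 b ≡ 1ℚ) ⊎ (c ≡ 2 × 𝟙 a +ℚ 𝟙 b ≡ 0ℚ)
two-copies true  true  _    ()  _
two-copies true  false {x = zero} {zero} c≡0 _ _ = inj₁ (c≡0 , refl)
two-copies false true  {x = zero} {zero} c≡0 _ _ = inj₁ (c≡0 , refl)
two-copies false false c≡x+y x≡1 y≡1 = inj₂ (trans c≡x+y (cong₂ _+_ x≡1 y≡1) , refl)
two-copies true  false {x = suc _} _ () _
two-copies true  false {x = zero} {suc _} _ _ ()
two-copies false true  {x = suc _} _ () _
two-copies false true  {x = zero} {suc _} _ _ ()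

χ-∧+χ-∧ : ∀ a b t → a ∧ b ≡ false → χ (a ∧ t) + χ (b ∧ t) ≡ χ (t ∧ (a ∨ b))
χ-∧+χ-∧ true  false true  _ = refl
χ-∧+χ-∧ true  false false _ = refl
χ-∧+χ-∧ false true  true  _ = refl
χ-∧+χ-∧ false true  false _ = refl
χ-∧+χ-∧ false false true  _ = refl
χ-∧+χ-∧ false false false _ = refl

if-χ : ∀ m b → (if m then χ b else 0) ≡ χ (b ∧ m)
if-χ true  b = cong χ (sym (∧-identityʳ b))
if-χ false b = cong χ (sym (∧-zeroʳ b))

module _ (H : Graph) (r : Fin (nV H)) (side : Fin (nE H) → Bool) where

  private
    Ĥ : Graph
    Ĥ = hatH H r side

  liftEnd-r₁ : ∀ e x → (liftEnd H r side e x == inject₁ r) ≡ (x == r) ∧ not (side e)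
  liftEnd-r₁ e x with x == r in x==r | side e
  ... | true  | true  = ≢⇒== Fin.fromℕ≢inject₁
  ... | true  | false = ≡⇒== refl
  ... | false | _     = trans (==-injective inject₁ Fin.inject₁-injective x r) x==r

  liftEnd-r₂ : ∀ e x → (liftEnd H r side e x == fromℕ (nV H)) ≡ (x == r) ∧ side e
  liftEnd-r₂ e x with x == r in x==r | side e
  ... | true  | true  = ≡⇒== refl
  ... | true  | false = ≢⇒== (Fin.fromℕ≢inject₁ ∘ sym)
  ... | false | _     = ≢⇒== (Fin.fromℕ≢inject₁ ∘ sym)

  new-edge-at-r₁ : inc Ĥ (inject₁ r) zero ≡ 1
  new-edge-at-r₁ = cong₂ (λ a b → χ a + χ b) (≡⇒== {x = inject₁ r} refl)
                                            (≢⇒== {x = fromℕ (nV H)} Fin.fromℕ≢inject₁)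

  new-edge-at-r₂ : inc Ĥ (fromℕ (nV H)) zero ≡ 1
  new-edge-at-r₂ = cong₂ (λ a b → χ a + χ b) (≢⇒== {x = inject₁ r} (Fin.fromℕ≢inject₁ ∘ sym))
                                            (≡⇒== {x = fromℕ (nV H)} refl)

  covered-once : ∀ M → IsPerfectMatching Ĥ M → ∀ v (t : Fin (nE H) → Bool) →
                 inc Ĥ v zero ≡ 1 → (∀ e → inc Ĥ v (suc (suc e)) ≡ χ (t e ∧ incident H r e)) →
                 χ (lookup M zero) + (χ (lookup M (suc zero)) +
                   count (nE H) (λ e → t e ∧ (incident H r e ∧ inM H M e))) ≡ 1
  covered-once M perfect v t new old =
    trans (cong₂ _+_ (cong (λ x → if lookup M zero then x else 0) (sym new))
                     (cong₂ _+_ (cong (λ x → if lookup M (suc zero) then x else 0) (sym new))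
                                (sym (trans (Σℕ-cong (nE H) old-in-M) (Σℕ-χ (nE H) _)))))
          (perfect v)
    where
    old-in-M : ∀ e → (if inM H M e then inc Ĥ v (suc (suc e)) else 0) ≡
                     χ (t e ∧ (incident H r e ∧ inM H M e))
    old-in-M e = trans (cong (λ x → if inM H M e then x else 0) (old e))
                       (trans (if-χ (inM H M e) _) (cong χ (∧-assoc (t e) _ _)))

  module _ (no-loop-at-r : ∀ e → (src H e == r) ∧ (tgt H e == r) ≡ false) where

    old-edge-at-r₁ : ∀ e → inc Ĥ (inject₁ r) (suc (suc e)) ≡ χ (not (side e) ∧ incident H r e)
    old-edge-at-r₁ e = trans (cong₂ (λ a b → χ a + χ b) (liftEnd-r₁ e (src H e)) (liftEnd-r₁ e (tgt H e)))
                             (χ-∧+χ-∧ (src H e == r) (tgt H e == r) (not (side e)) (no-loop-at-r e))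

    old-edge-at-r₂ : ∀ e → inc Ĥ (fromℕ (nV H)) (suc (suc e)) ≡ χ (side e ∧ incident H r e)
    old-edge-at-r₂ e = trans (cong₂ (λ a b → χ a + χ b) (liftEnd-r₂ e (src H e)) (liftEnd-r₂ e (tgt H e)))
                             (χ-∧+χ-∧ (src H e == r) (tgt H e == r) (side e) (no-loop-at-r e))

    matching-cases : ∀ M → IsPerfectMatching Ĥ M →
                     (cBd H r M ≡ 0 × newEdges M ≡ 1ℚ) ⊎ (cBd H r M ≡ 2 × newEdges M ≡ 0ℚ)
    matching-cases M perfect =
      two-copies (lookup M zero) (lookup M (suc zero))
        (count-split (nE H) side (λ e → incident H r e ∧ inM H M e))
        (covered-once M perfect (inject₁ r) (not ∘ side) new-edge-at-r₁ old-edge-at-r₁)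
        (covered-once M perfect (fromℕ (nV H)) side new-edge-at-r₂ old-edge-at-r₂)

module _ (H : Graph) (r : Fin (nV H)) (M : Subset (suc (suc (nE H)))) where

  pickE-outside : ∀ e → inBoundary H r e ≡ false → pickE H r M e ≡ 0ℚ
  pickE-outside e e∉∂I with cBd H r M
  ... | 0                 rewrite e∉∂I = refl
  ... | 1                 = refl
  ... | 2                 rewrite e∉∂I = refl
  ... | suc (suc (suc _)) = refl

  pickE-decrease : cBd H r M ≡ 0 → ∀ e → pickE H r M e ≡ (if inBoundary H r e then ¼ else 0ℚ)
  pickE-decrease none e rewrite none = refl

  pickE-increase : cBd H r M ≡ 2 → ∀ e →
                   pickE H r M e ≡ (if inBoundary H r e ∧ inM H M e then ½ else 0ℚ)
  pickE-increase two e rewrite two = refl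

  delta-decrease : cBd H r M ≡ 0 → delta H r M ≡ - ⅓
  delta-decrease none rewrite none = refl

  delta-increase : cBd H r M ≡ 2 → delta H r M ≡ ⅓
  delta-increase two rewrite two = refl

module _ (H : Graph) (four : 4 ≤ nV H) (reg : FourRegular H)
         (fec : FourEdgeConnected H) (npm : NoProperMinCut H) (r : Fin (nV H)) where

  pickF-total : ∀ e → inBoundary H r e ≡ true → Σℚ (nE H) (pickF H r e) ≡ 1ℚ
  pickF-total e e∈∂I = trans (Σℚ-if (nE H) (adjInternal H r e) ⅓)
                             (cong (_×ℚ ⅓) (adjInternal-count H four reg fec npm e∈∂I))

  pickE-stochastic : ∀ M e → pickE H r M e *ℚ Σℚ (nE H) (pickF H r e) ≡ pickE H r M e
  pickE-stochastic M e with inBoundary H r e in e∈∂I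
  ... | true  = trans (cong (pickE H r M e *ℚ_) (pickF-total e e∈∂I)) (ℚ.*-identityʳ _)
  ... | false = trans (cong (_*ℚ Σℚ (nE H) (pickF H r e)) (pickE-outside H r M e e∈∂I))
                      (trans (ℚ.*-zeroˡ (Σℚ (nE H) (pickF H r e))) (sym (pickE-outside H r M e e∈∂I)))

  module Target (side : Fin (nE H) → Bool) (f : Fin (nE H)) where

    -- Pr[the second step picks f | the first step picked e], for e ∈ ∂I.
    hit : Fin (nE H) → ℚ
    hit e = 𝟙 (inBoundary H r e) *ℚ pickF H r e f

    hits : ℚ
    hits = Σℚ (nE H) hit

    hitsIn : Subset (suc (suc (nE H))) → ℚ
    hitsIn M = Σℚ (nE H) (λ e → hit e *ℚ 𝟙 (inM H M e))

    pickE-total : ∀ M → IsPerfectMatching (hatH H r side) M → Σℚ (nE H) (pickE H r M) ≡ 1ℚ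
    pickE-total M perfect with matching-cases H r side (no-loop H four reg fec npm r) M perfect
    ... | inj₁ (none , _) = begin
      Σℚ (nE H) (pickE H r M)
        ≡⟨ Σℚ-cong (nE H) (pickE-decrease H r M none) ⟩
      Σℚ (nE H) (λ e → if inBoundary H r e then ¼ else 0ℚ)
        ≡⟨ Σℚ-if (nE H) (inBoundary H r) ¼ ⟩
      count (nE H) (inBoundary H r) ×ℚ ¼
        ≡⟨ cong (_×ℚ ¼) (count-incident H four reg fec npm r) ⟩
      4 ×ℚ ¼ ∎
      where open ≡-Reasoning
    ... | inj₂ (two , _)  = begin
      Σℚ (nE H) (pickE H r M)
        ≡⟨ Σℚ-cong (nE H) (pickE-increase H r M two) ⟩
      Σℚ (nE H) (λ e → if inBoundary H r e ∧ inM H M e then ½ else 0ℚ)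
        ≡⟨ Σℚ-if (nE H) (λ e → inBoundary H r e ∧ inM H M e) ½ ⟩
      cBd H r M ×ℚ ½
        ≡⟨ cong (_×ℚ ½) two ⟩
      2 ×ℚ ½ ∎
      where open ≡-Reasoning

    correction : Subset (suc (suc (nE H))) → ℚ
    correction M = ((- ⅓ *ℚ ¼) *ℚ hits) *ℚ newEdges M +ℚ (⅓ *ℚ ½) *ℚ hitsIn M

    correction-given : ∀ M → IsPerfectMatching (hatH H r side) M →
                       delta H r M *ℚ Σℚ (nE H) (λ e → pickE H r M e *ℚ pickF H r e f) ≡ correction M
    correction-given M perfect with matching-cases H r side (no-loop H four reg fec npm r) M perfect
    ... | inj₁ (none , one-new) = begin
      delta H r M *ℚ Σℚ (nE H) (λ e → pickE H r M e *ℚ pickF H r e f)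
        ≡⟨ cong₂ _*ℚ_ (delta-decrease H r M none) (Σℚ-cong (nE H) (λ e →
             trans (cong (_*ℚ pickF H r e f) (pickE-decrease H r M none e)) (if-*ℚ (inBoundary H r e) ¼ _))) ⟩
      - ⅓ *ℚ Σℚ (nE H) (λ e → ¼ *ℚ hit e)
        ≡⟨ cong (- ⅓ *ℚ_) (*-distribˡ-Σℚ (nE H) ¼ hit) ⟨
      - ⅓ *ℚ (¼ *ℚ hits)
        ≡⟨ decrease hits ⟩
      ((- ⅓ *ℚ ¼) *ℚ hits) *ℚ 1ℚ +ℚ (⅓ *ℚ ½) *ℚ 0ℚ
        ≡⟨ cong₂ (λ n s → ((- ⅓ *ℚ ¼) *ℚ hits) *ℚ n +ℚ (⅓ *ℚ ½) *ℚ s) one-new no-hits ⟨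
      correction M ∎
      where
      open ≡-Reasoning
      no-hits : hitsIn M ≡ 0ℚ
      no-hits = trans (Σℚ-cong (nE H) (λ e → 𝟙-*-𝟙-disjoint (inBoundary H r e) (inM H M e) _
                                              (count≡0 (nE H) _ none e)))
                      (Σℚ-zero (nE H))
      decrease : ∀ h → - ⅓ *ℚ (¼ *ℚ h) ≡ ((- ⅓ *ℚ ¼) *ℚ h) *ℚ 1ℚ +ℚ (⅓ *ℚ ½) *ℚ 0ℚ
      decrease = solve 1 (λ h → con (- ⅓) :* (con ¼ :* h)
                               := ((con (- ⅓) :* con ¼) :* h) :* con 1ℚ :+ (con ⅓ :* con ½) :* con 0ℚ) refl
        where open +-*-Solver
    ... | inj₂ (two , no-new) = begin
      delta H r M *ℚ Σℚ (nE H) (λ e → pickE H r M e *ℚ pickF H r e f)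
        ≡⟨ cong₂ _*ℚ_ (delta-increase H r M two) (Σℚ-cong (nE H) (λ e →
             trans (cong (_*ℚ pickF H r e f) (pickE-increase H r M two e))
                   (if-∧-*ℚ (inBoundary H r e) (inM H M e) ½ _))) ⟩
      ⅓ *ℚ Σℚ (nE H) (λ e → ½ *ℚ (hit e *ℚ 𝟙 (inM H M e)))
        ≡⟨ cong (⅓ *ℚ_) (*-distribˡ-Σℚ (nE H) ½ _) ⟨
      ⅓ *ℚ (½ *ℚ hitsIn M)
        ≡⟨ increase hits (hitsIn M) ⟩
      ((- ⅓ *ℚ ¼) *ℚ hits) *ℚ 0ℚ +ℚ (⅓ *ℚ ½) *ℚ hitsIn M
        ≡⟨ cong (λ n → ((- ⅓ *ℚ ¼) *ℚ hits) *ℚ n +ℚ (⅓ *ℚ ½) *ℚ hitsIn M) no-new ⟨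
      correction M ∎
      where
      open ≡-Reasoning
      increase : ∀ h s → ⅓ *ℚ (½ *ℚ s) ≡ ((- ⅓ *ℚ ¼) *ℚ h) *ℚ 0ℚ +ℚ (⅓ *ℚ ½) *ℚ s
      increase = solve 2 (λ h s → con ⅓ :* (con ½ :* s)
                                 := ((con (- ⅓) :* con ¼) :* h) :* con 0ℚ :+ (con ⅓ :* con ½) :* s) refl
        where open +-*-Solver

    expectedHatY-given : Subset (suc (suc (nE H))) → ℚ
    expectedHatY-given M =
      Σℚ (nE H) (λ e → Σℚ (nE H) (λ g → pickE H r M e *ℚ (pickF H r e g *ℚ hatY H r M g f)))

    expectedHatY-given-perfect : ∀ M → IsPerfectMatching (hatH H r side) M →
                                 expectedHatY-given M ≡ yVal H M f +ℚ correction M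
    expectedHatY-given-perfect M perfect =
      trans (two-stage-choice (nE H) (pickE H r M) (pickF H r) (yVal H M f) (delta H r M) f
                              (pickE-total M perfect) (pickE-stochastic M))
            (cong (yVal H M f +ℚ_) (correction-given M perfect))

    module _ (D : MatchingDist H r side) where
      open Expectation D

      expectedHatY≡𝔼-given : expectedHatY H r side D f ≡ 𝔼 expectedHatY-given
      expectedHatY≡𝔼-given = Σℚ-cong (k D) (λ i →
        trans (Σℚ-cong (nE H) (λ e → sym (*-distribˡ-Σℚ (nE H) (prob D i) _)))
              (sym (*-distribˡ-Σℚ (nE H) (prob D i) _)))

      𝔼-expectedHatY-given :
        𝔼 expectedHatY-given ≡
        𝔼 (λ M → yVal H M f) +ℚ (((- ⅓ *ℚ ¼) *ℚ hits) *ℚ 𝔼 newEdges +ℚ (⅓ *ℚ ½) *ℚ 𝔼 hitsIn)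
      𝔼-expectedHatY-given =
        trans (𝔼-cong {X = expectedHatY-given} {Y = λ M → yVal H M f +ℚ correction M}
                      (λ i → expectedHatY-given-perfect (mat D i) (perfect D i)))
              (𝔼-affine (λ M → yVal H M f) newEdges hitsIn ((- ⅓ *ℚ ¼) *ℚ hits) (⅓ *ℚ ½))

      𝔼-yVal : 𝔼 (λ M → yVal H M f) ≡ ½
      𝔼-yVal = begin
        𝔼 (λ M → yVal H M f)
          ≡⟨ 𝔼-cong {X = λ M → yVal H M f} {Y = λ M → ⅓ +ℚ ⅔ *ℚ 𝟙 (inM H M f)}
                    (λ i → yVal≡ (inM H (mat D i) f)) ⟩
        𝔼 (λ M → ⅓ +ℚ ⅔ *ℚ 𝟙 (inM H M f))
          ≡⟨ 𝔼-+ (λ _ → ⅓) (λ M → ⅔ *ℚ 𝟙 (inM H M f)) ⟩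
        𝔼 (λ _ → ⅓) +ℚ 𝔼 (λ M → ⅔ *ℚ 𝟙 (inM H M f))
          ≡⟨ cong₂ _+ℚ_ (𝔼-const ⅓) (𝔼-* ⅔ (λ M → 𝟙 (inM H M f))) ⟩
        ⅓ +ℚ ⅔ *ℚ 𝔼 (λ M → 𝟙 (inM H M f))
          ≡⟨ cong (λ p → ⅓ +ℚ ⅔ *ℚ p) (𝔼-𝟙 (suc (suc f))) ⟩
        ½ ∎
        where
        open ≡-Reasoning
        yVal≡ : ∀ b → (if b then 1ℚ else ⅓) ≡ ⅓ +ℚ ⅔ *ℚ 𝟙 b
        yVal≡ true  = refl
        yVal≡ false = refl

      𝔼-newEdges : 𝔼 newEdges ≡ ½
      𝔼-newEdges = trans (𝔼-+ (λ M → 𝟙 (lookup M zero)) (λ M → 𝟙 (lookup M (suc zero))))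
                         (cong₂ _+ℚ_ (𝔼-𝟙 zero) (𝔼-𝟙 (suc zero)))

      𝔼-hitsIn : 𝔼 hitsIn ≡ hits *ℚ ¼
      𝔼-hitsIn = begin
        𝔼 hitsIn
          ≡⟨ 𝔼-Σℚ (nE H) (λ e M → hit e *ℚ 𝟙 (inM H M e)) ⟩
        Σℚ (nE H) (λ e → 𝔼 (λ M → hit e *ℚ 𝟙 (inM H M e)))
          ≡⟨ Σℚ-cong (nE H) (λ e → trans (𝔼-* (hit e) (λ M → 𝟙 (inM H M e)))
                                           (cong (hit e *ℚ_) (𝔼-𝟙 (suc (suc e))))) ⟩
        Σℚ (nE H) (λ e → hit e *ℚ ¼)
          ≡⟨ *-distribʳ-Σℚ (nE H) ¼ hit ⟨
        hits *ℚ ¼ ∎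
        where open ≡-Reasoning

-- Oddness of |V| and SplitOK only ensure that some D exists, and f need not be internal.
claimB2 : (H : Graph) (r : Fin (nV H)) (side : Fin (nE H) → Bool) →
          4 ≤ nV H → nV H % 2 ≡ 1 →
          FourRegular H → FourEdgeConnected H → NoProperMinCut H →
          SplitOK H r side →
          (D : MatchingDist H r side) →
          (f : Fin (nE H)) → internal H r f ≡ true →
          expectedHatY H r side D f ≡ ½
claimB2 H r side four _ reg fec npm _ D f _ = begin
  expectedHatY H r side D f
    ≡⟨ expectedHatY≡𝔼-given D ⟩
  𝔼 expectedHatY-given
    ≡⟨ 𝔼-expectedHatY-given D ⟩
  𝔼 (λ M → yVal H M f) +ℚ (κ *ℚ 𝔼 newEdges +ℚ (⅓ *ℚ ½) *ℚ 𝔼 hitsIn)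
    ≡⟨ cong₂ (λ y n → y +ℚ (κ *ℚ n +ℚ (⅓ *ℚ ½) *ℚ 𝔼 hitsIn)) (𝔼-yVal D) (𝔼-newEdges D) ⟩
  ½ +ℚ (κ *ℚ ½ +ℚ (⅓ *ℚ ½) *ℚ 𝔼 hitsIn)
    ≡⟨ cong (λ s → ½ +ℚ (κ *ℚ ½ +ℚ (⅓ *ℚ ½) *ℚ s)) (𝔼-hitsIn D) ⟩
  ½ +ℚ (κ *ℚ ½ +ℚ (⅓ *ℚ ½) *ℚ (hits *ℚ ¼))
    ≡⟨ cancel hits ⟩
  ½ ∎
  where
  open ≡-Reasoning
  open Expectation D
  open Target H four reg fec npm r side f
  κ : ℚ
  κ = (- ⅓ *ℚ ¼) *ℚ hits
  cancel : ∀ h → ½ +ℚ (((- ⅓ *ℚ ¼) *ℚ h) *ℚ ½ +ℚ (⅓ *ℚ ½) *ℚ (h *ℚ ¼)) ≡ ½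
  cancel = solve 1 (λ h → con ½ :+ (((con (- ⅓) :* con ¼) :* h) :* con ½
                                    :+ (con ⅓ :* con ½) :* (h :* con ¼))
                          := con ½) refl
    where open +-*-Solver
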